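{- If $B\subseteq F(2^{\mathbb{Z}^2})$ is Borel, then there is an $x\in F(2^{\mathbb{Z}^2})$ such that either $\{s\in\mathbb{Z}^2: s\cdot x\in B\}$ or $\{s\in\mathbb{Z}^2: s\cdot x\in 2^{\mathbb{Z}^2}\setminus B\}$ contains a lattice $L$ in $\mathbb{Z}^2$.
   Context: $\mathbb{Z}^2$ acts on $2^{\mathbb{Z}^2}$ by the Bernoulli shift $(g\cdot x)(h)=x(h-g)$; $F(2^{\mathbb{Z}^2})$ is the set of $x$ with $g\cdot x\neq x$ for all $g\neq(0,0)$. Here a lattice means a set of the form $k+\{(iw,jh):(i,j)\in\mathbb{Z}^2\}$ with $k\in\mathbb{Z}^2$ and $w,h$ positive integers. -}

module Defs where

open import Data.Bool using (Bool)
open import Data.Nat using (ℕ; suc)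
open import Data.Integer using (ℤ; +_; _+_; _-_; _*_)
open import Data.Product using (Σ; _×_; _,_)
open import Data.Sum using (_⊎_)
open import Relation.Nullary using (¬_; Dec)
open import Relation.Binary.PropositionalEquality using (_≡_)
open import Function.Bundles using (_⇔_)
open import Level using (Level; 0ℓ) renaming (suc to lsuc)

ℤ² : Set
ℤ² = ℤ × ℤ

_+²_ : ℤ² → ℤ² → ℤ²
(a , b) +² (c , d) = (a + c , b + d)

_-²_ : ℤ² → ℤ² → ℤ²
(a , b) -² (c , d) = (a - c , b - d)

zero² : ℤ²
zero² = (+ 0 , + 0)

Point : Set
Point = ℤ² → Bool

_·_ : ℤ² → Point → Point
(g · x) h = x (h -² g)

Free : Point → Set
Free x = (g : ℤ²) → ¬ (g ≡ zero²) → ¬ ((h : ℤ²) → (g · x) h ≡ x h)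

-- Borel subsets of 2^{ℤ²} (product topology): the smallest class of
-- predicates containing the subbasic clopen cylinders {x | x p = b},
-- closed under complements, countable unions, and extensional equivalence.
data Borel : (Point → Set) → Set₁ where
  cyl   : (p : ℤ²) (b : Bool) → Borel (λ x → x p ≡ b)
  compl : {A : Point → Set} → Borel A → Borel (λ x → ¬ A x)
  union : (A : ℕ → Point → Set) → ((n : ℕ) → Borel (A n)) →
          Borel (λ x → Σ ℕ (λ n → A n x))
  ext   : {A B : Point → Set} → Borel A → ((x : Point) → A x ⇔ B x) → Borel B

ContainsLattice : (ℤ² → Set) → Set
ContainsLattice S =
  Σ ℤ² λ k → Σ ℕ λ w → Σ ℕ λ h →
    (i j : ℤ) → S (k +² (i * + suc w , j * + suc h))

-- Classical logic (the paper works in ZFC).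
ExcludedMiddle : Set₁
ExcludedMiddle = (P : Set) → Dec P

-- Forcing with partial colourings of ℤ² that are periodic modulo a
-- rectangular lattice and leave some point uncoloured. Every Borel set B is
-- decided densely: relative to countably many dense sets of conditions, each
-- condition has an extension c forcing B or forcing its complement, for free
-- points meeting those dense sets (the Baire property of B). Closing the dense
-- sets under translations and interleaving steps that rule out each possible
-- period in turn, one builds a free generic point x extending c. Translating
-- x by a vector of the period lattice of c keeps it free, generic and
-- extending c, so all these translates lie on the side of B that c forces.
module Submission where

open import Defs
open import Data.Bool as Bool using (Bool; false; not)
open import Data.Bool.Properties using (not-¬)
open import Data.Empty using (⊥-elim)
open import Data.Integer as ℤ using (ℤ; +_; -[1+_]; _+_; _-_; _*_; -_; ∣_∣; 0ℤ; -1ℤ)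
import Data.Integer.Properties as ℤ
open import Data.Integer.Divisibility.Signed
  using (_∣_; divides; _∣?_; ∣ᵤ⇒∣; ∣⇒∣ᵤ; ∣-trans; ∣m∣n⇒∣m+n; ∣m⇒∣-m)
open import Data.Integer.Tactic.RingSolver using (solve-∀)
open import Data.Maybe using (Maybe; just; nothing; _<∣>_; when)
open import Data.Maybe.Properties using (just-injective)
open import Data.Nat as ℕ using (ℕ; zero; suc; pred; _<_; _≤′_; ≤′-refl; ≤′-step)
import Data.Nat.Properties as ℕ
import Data.Nat.Divisibility as ℕ
open import Data.Product as Product using (Σ; ∃; _×_; _,_; proj₁; proj₂)
open import Data.Sum as Sum using (_⊎_; inj₁; inj₂)
open import Function using (_∘_)
open import Function.Bundles using (mk⇔; _⇔_; Equivalence)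
open import Function.Definitions using (StrictlySurjective)
open import Relation.Nullary using (¬_; Dec; yes; no; does)
open import Relation.Nullary.Decidable using (does-⇔; dec-true; dec-false; _×-dec_; map′)
open import Relation.Binary.PropositionalEquality

-- Enumerations

step : ℕ × ℕ → ℕ × ℕ
step (zero  , j) = suc j , 0
step (suc i , j) = i , suc j

unpair : ℕ → ℕ × ℕ
unpair zero    = 0 , 0
unpair (suc n) = step (unpair n)

unpair-surjective : StrictlySurjective _≡_ unpair
unpair-surjective (i , j) =
  subst (λ j' → Reached (i , j')) (ℕ.+-identityʳ j)
    (walk j (subst Reached (cong (_, 0) (ℕ.+-comm i j)) (axis (i ℕ.+ j))))
  where
  Reached : ℕ × ℕ → Set
  Reached p = ∃ λ n → unpair n ≡ p

  next : ∀ {p} → Reached p → Reached (step p)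
  next (n , e) = suc n , cong step e

  walk : ∀ k {i j} → Reached (k ℕ.+ i , j) → Reached (i , k ℕ.+ j)
  walk zero    r = r
  walk (suc k) {i} {j} r = subst (λ j' → Reached (i , j')) (ℕ.+-suc k j) (walk k (next r))

  axis : ∀ d → Reached (d , 0)
  axis zero    = 0 , refl
  axis (suc d) = next (subst (λ j → Reached (0 , j)) (ℕ.+-identityʳ d)
                         (walk d (subst (λ i → Reached (i , 0)) (sym (ℕ.+-identityʳ d)) (axis d))))

unpair-map-surjective : ∀ {A B : Set} {f : ℕ → A} {g : ℕ → B} →
  StrictlySurjective _≡_ f → StrictlySurjective _≡_ g →
  StrictlySurjective _≡_ (Product.map f g ∘ unpair)
unpair-map-surjective f-onto g-onto (a , b) with f-onto a | g-onto b
... | i , refl | j , refl = Product.map₂ (cong (Product.map _ _)) (unpair-surjective (i , j))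

ℕ→ℤ : ℕ → ℤ
ℕ→ℤ n = + proj₁ (unpair n) - + proj₂ (unpair n)

ℕ→ℤ-surjective : StrictlySurjective _≡_ ℕ→ℤ
ℕ→ℤ-surjective (+ k) with unpair-surjective (k , 0)
... | n , e = n , trans (cong (λ (a , b) → + a - + b) e) (ℤ.+-identityʳ (+ k))
ℕ→ℤ-surjective -[1+ k ] with unpair-surjective (0 , suc k)
... | n , e = n , cong (λ (a , b) → + a - + b) e

ℕ→ℤ² : ℕ → ℤ²
ℕ→ℤ² = Product.map ℕ→ℤ ℕ→ℤ ∘ unpair

ℕ→ℤ²-surjective : StrictlySurjective _≡_ ℕ→ℤ²
ℕ→ℤ²-surjective = unpair-map-surjective ℕ→ℤ-surjective ℕ→ℤ-surjective

-- Congruence modulo a rectangular lattice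

infix 4 _≡_[mod_] _≡_mod⟨_,_⟩

-- Both congruences are records so that their indices can be inferred.
record _≡_[mod_] (a b : ℤ) (m : ℕ) : Set where
  constructor ≡mod
  field divides-difference : + m ∣ a - b

≡mod-refl : ∀ {m} a → a ≡ a [mod m ]
≡mod-refl a = ≡mod (divides 0ℤ (ℤ.+-inverseʳ a))

≡mod-sym : ∀ {m a b} → a ≡ b [mod m ] → b ≡ a [mod m ]
≡mod-sym {m} {a} {b} (≡mod m∣a-b) = ≡mod (subst (+ m ∣_) (swap a b) (∣m⇒∣-m m∣a-b))
  where
  swap : ∀ a b → - (a - b) ≡ b - a
  swap = solve-∀

≡mod-trans : ∀ {m a b c} → a ≡ b [mod m ] → b ≡ c [mod m ] → a ≡ c [mod m ]
≡mod-trans {m} {a} {b} {c} (≡mod m∣a-b) (≡mod m∣b-c) =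
  ≡mod (subst (+ m ∣_) (ℤ.+-minus-telescope a b c) (∣m∣n⇒∣m+n m∣a-b m∣b-c))

≡mod-coarsen : ∀ {m n a b} → m ℕ.∣ n → a ≡ b [mod n ] → a ≡ b [mod m ]
≡mod-coarsen m∣n (≡mod n∣a-b) = ≡mod (∣-trans (∣ᵤ⇒∣ m∣n) n∣a-b)

≡mod-translate : ∀ {m a b} c → a ≡ b [mod m ] → a + c ≡ b + c [mod m ]
≡mod-translate {m} {a} {b} c (≡mod m∣a-b) = ≡mod (subst (+ m ∣_) (cancel a b c) m∣a-b)
  where
  cancel : ∀ a b c → a - b ≡ (a + c) - (b + c)
  cancel = solve-∀

a+d-a≡d : ∀ a d → (a + d) - a ≡ d
a+d-a≡d = solve-∀

∣⇒+≡mod : ∀ {m} a {d} → + m ∣ d → a + d ≡ a [mod m ]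
∣⇒+≡mod {m} a {d} m∣d = ≡mod (subst (+ m ∣_) (sym (a+d-a≡d a d)) m∣d)

+≡mod⇒∣ : ∀ {m a d} → a + d ≡ a [mod m ] → + m ∣ d
+≡mod⇒∣ {m} {a} {d} (≡mod m∣a+d-a) = subst (+ m ∣_) (a+d-a≡d a d) m∣a+d-a

small-multiple≡0 : ∀ {m d} → + m ∣ d → ∣ d ∣ < m → d ≡ 0ℤ
small-multiple≡0 {m} {d} m∣d small with ∣ d ∣ in eq
... | zero  = ℤ.∣i∣≡0⇒i≡0 eq
... | suc _ = ⊥-elim (ℕ.>⇒∤ small (subst (m ℕ.∣_) eq (∣⇒∣ᵤ m∣d)))

_≡?_[mod_] : ∀ a b m → Dec (a ≡ b [mod m ])
a ≡? b [mod m ] = map′ ≡mod _≡_[mod_].divides-difference (+ m ∣? a - b)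

record _≡_mod⟨_,_⟩ (z z' : ℤ²) (m n : ℕ) : Set where
  constructor _,_
  field
    ≡mod₁ : proj₁ z ≡ proj₁ z' [mod m ]
    ≡mod₂ : proj₂ z ≡ proj₂ z' [mod n ]

≡mod⟨⟩-refl : ∀ {m n} z → z ≡ z mod⟨ m , n ⟩
≡mod⟨⟩-refl (a , b) = ≡mod-refl a , ≡mod-refl b

≡mod⟨⟩-sym : ∀ {m n z z'} → z ≡ z' mod⟨ m , n ⟩ → z' ≡ z mod⟨ m , n ⟩
≡mod⟨⟩-sym (a≡ , b≡) = ≡mod-sym a≡ , ≡mod-sym b≡

≡mod⟨⟩-trans : ∀ {m n z z' z''} →
  z ≡ z' mod⟨ m , n ⟩ → z' ≡ z'' mod⟨ m , n ⟩ → z ≡ z'' mod⟨ m , n ⟩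
≡mod⟨⟩-trans (a≡ , b≡) (a≡' , b≡') = ≡mod-trans a≡ a≡' , ≡mod-trans b≡ b≡'

≡mod⟨⟩-coarsen : ∀ {m n m' n' z z'} → m' ℕ.∣ m → n' ℕ.∣ n →
  z ≡ z' mod⟨ m , n ⟩ → z ≡ z' mod⟨ m' , n' ⟩
≡mod⟨⟩-coarsen m'∣m n'∣n (a≡ , b≡) = ≡mod-coarsen m'∣m a≡ , ≡mod-coarsen n'∣n b≡

≡mod⟨⟩-translate : ∀ {m n z z'} s → z ≡ z' mod⟨ m , n ⟩ → z +² s ≡ z' +² s mod⟨ m , n ⟩
≡mod⟨⟩-translate (c , d) (a≡ , b≡) = ≡mod-translate c a≡ , ≡mod-translate d b≡

≡mod⟨⟩-period : ∀ {m n} z → z -² (+ m , 0ℤ) ≡ z mod⟨ m , n ⟩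
≡mod⟨⟩-period (a , b) = ∣⇒+≡mod a (divides -1ℤ (sym (ℤ.-1*i≡-i _))) , ∣⇒+≡mod b (divides 0ℤ refl)

≡mod⟨⟩-lattice : ∀ {m n} z i j → z -² (zero² +² (i * + m , j * + n)) ≡ z mod⟨ m , n ⟩
≡mod⟨⟩-lattice (a , b) i j =
  ∣⇒+≡mod a (divides (- i) (shape i _)) , ∣⇒+≡mod b (divides (- j) (shape j _))
  where
  shape : ∀ i m → - (0ℤ + i * m) ≡ (- i) * m
  shape = solve-∀

small-period≡0 : ∀ {m n} z g → ∣ proj₁ g ∣ < m → ∣ proj₂ g ∣ < n →
  z -² g ≡ z mod⟨ m , n ⟩ → g ≡ zero²
small-period≡0 z (a , b) a<m b<n (a≡ , b≡) = cong₂ _,_ (vanishes a a<m a≡) (vanishes b b<n b≡)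
  where
  vanishes : ∀ {m c} a → ∣ a ∣ < m → c - a ≡ c [mod m ] → a ≡ 0ℤ
  vanishes a a<m c-a≡c =
    ℤ.neg-injective (small-multiple≡0 (+≡mod⇒∣ c-a≡c) (subst (_< _) (sym (ℤ.∣-i∣≡∣i∣ a)) a<m))

_≡?_mod⟨_,_⟩ : ∀ z z' m n → Dec (z ≡ z' mod⟨ m , n ⟩)
(a , b) ≡? (a' , b') mod⟨ m , n ⟩ =
  map′ (λ (a≡ , b≡) → a≡ , b≡) (λ (a≡ , b≡) → a≡ , b≡) (a ≡? a' [mod m ] ×-dec b ≡? b' [mod n ])

z+s-s≡z : ∀ z s → (z +² s) -² s ≡ z
z+s-s≡z (a , b) (c , d) = cong₂ _,_ (cancel a c) (cancel b d)
  where
  cancel : ∀ a c → (a + c) - c ≡ a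
  cancel = solve-∀

z-s+s≡z : ∀ z s → (z -² s) +² s ≡ z
z-s+s≡z (a , b) (c , d) = cong₂ _,_ (cancel a c) (cancel b d)
  where
  cancel : ∀ a c → (a - c) + c ≡ a
  cancel = solve-∀

-²-comm : ∀ z s t → (z -² s) -² t ≡ (z -² t) -² s
-²-comm (a , b) (c , d) (e , f) = cong₂ _,_ (swap a c e) (swap b d f)
  where
  swap : ∀ a c e → (a - c) - e ≡ (a - e) - c
  swap = solve-∀

Periodic : ℤ² → Point → Set
Periodic g x = ∀ z → (g · x) z ≡ x z

Periodic-· : ∀ {g x} s → Periodic g (s · x) → Periodic g x
Periodic-· {g} {x} s periodic z = begin
  x (z -² g)                ≡⟨ cong (x ∘ (_-² g)) (z+s-s≡z z s) ⟨
  x (((z +² s) -² s) -² g)  ≡⟨ cong x (-²-comm (z +² s) s g) ⟩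
  x (((z +² s) -² g) -² s)  ≡⟨ periodic (z +² s) ⟩
  x ((z +² s) -² s)         ≡⟨ cong x (z+s-s≡z z s) ⟩
  x z                       ∎
  where open ≡-Reasoning

Free-· : ∀ {x} s → Free x → Free (s · x)
Free-· s free g g≢0 = free g g≢0 ∘ Periodic-· s

-- Periodic partial colourings

record Pattern : Set where
  field
    w h         : ℕ
    colour      : ℤ² → Maybe Bool
    colour-cong : ∀ {z z'} → z ≡ z' mod⟨ suc w , suc h ⟩ → colour z ≡ colour z'
open Pattern

infix 4 _≼_

_≼_ : Pattern → Pattern → Set
c ≼ d = ∀ z {b} → colour d z ≡ just b → colour c z ≡ just b

≼-refl : ∀ {c} → c ≼ c
≼-refl z e = e

Extends : Point → Pattern → Set
Extends x c = ∀ z {b} → colour c z ≡ just b → x z ≡ b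

total-not-free : ∀ {x} c → (∀ z → ¬ colour c z ≡ nothing) → Extends x c → ¬ Free x
total-not-free {x} c total x⊇c free = free (+ suc (w c) , 0ℤ) (λ ()) periodic
  where
  periodic : Periodic (+ suc (w c) , 0ℤ) x
  periodic z with colour c z in e
  ... | nothing = ⊥-elim (total z e)
  ... | just b  = trans (x⊇c _ (trans (colour-cong c (≡mod⟨⟩-period z)) e)) (sym (x⊇c z e))

Extends-lattice : ∀ {x} c i j → Extends x c →
  Extends ((zero² +² (i * + suc (w c) , j * + suc (h c))) · x) c
Extends-lattice c i j x⊇c z e = x⊇c _ (trans (colour-cong c (≡mod⟨⟩-lattice z i j)) e)

infixl 6 _∪_

-- suc (pred (suc m ℕ.* suc n)) reduces to suc m ℕ.* suc n.
_∪_ : Pattern → Pattern → Pattern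
c ∪ d = record
  { w = pred (suc (w c) ℕ.* suc (w d))
  ; h = pred (suc (h c) ℕ.* suc (h d))
  ; colour = λ z → colour c z <∣> colour d z
  ; colour-cong = λ z≡z' → cong₂ _<∣>_
      (colour-cong c (≡mod⟨⟩-coarsen (ℕ.m∣m*n _) (ℕ.m∣m*n _) z≡z'))
      (colour-cong d (≡mod⟨⟩-coarsen (ℕ.n∣m*n (suc (w c))) (ℕ.n∣m*n (suc (h c))) z≡z')) }

∪-≼ˡ : ∀ {c d} → c ∪ d ≼ c
∪-≼ˡ z e rewrite e = refl

∪-≼ʳ : ∀ {x c d} → Extends x c → Extends x d → c ∪ d ≼ d
∪-≼ʳ {c = c} x⊇c x⊇d z e with colour c z in e'
... | just b' = cong just (trans (sym (x⊇c z e')) (x⊇d z e))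
... | nothing = e

∪-undefinedˡ : ∀ {c d z} → colour c z ≡ nothing → colour (c ∪ d) z ≡ colour d z
∪-undefinedˡ e rewrite e = refl

Extends-∪ : ∀ {x c d} → Extends x c → Extends x d → Extends x (c ∪ d)
Extends-∪ {c = c} x⊇c x⊇d z e with colour c z in e'
... | just b' = x⊇c z (trans e' e)
... | nothing = x⊇d z e

coset : (w h : ℕ) → ℤ² → Bool → Pattern
coset w h pt v = record
  { w = w ; h = h
  ; colour = λ z → when (does (z ≡? pt mod⟨ suc w , suc h ⟩)) v
  ; colour-cong = λ {z} {z'} z≡z' → cong (λ b → when b v) (does-⇔
      (mk⇔ (≡mod⟨⟩-trans (≡mod⟨⟩-sym z≡z')) (≡mod⟨⟩-trans z≡z'))
      (z ≡? pt mod⟨ suc w , suc h ⟩) (z' ≡? pt mod⟨ suc w , suc h ⟩)) }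

coset-∈ : ∀ {w h pt v z} → z ≡ pt mod⟨ suc w , suc h ⟩ → colour (coset w h pt v) z ≡ just v
coset-∈ {w} {h} {pt} {v} {z} z≡pt =
  cong (λ b → when b v) (dec-true (z ≡? pt mod⟨ suc w , suc h ⟩) z≡pt)

coset-∉ : ∀ {w h pt v z} → ¬ z ≡ pt mod⟨ suc w , suc h ⟩ → colour (coset w h pt v) z ≡ nothing
coset-∉ {w} {h} {pt} {v} {z} z≢pt =
  cong (λ b → when b v) (dec-false (z ≡? pt mod⟨ suc w , suc h ⟩) z≢pt)

-- The coset is taken modulo (k + 2) times the periods of c, so it cannot
-- contain both a hole of c and its translate by one period.
refine : ℕ → ℕ → ℕ
refine k p = suc p ℕ.* suc (suc k)

refinedCoset : ℕ → ℤ² → Bool → Pattern → Pattern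
refinedCoset k pt v c = coset (pred (refine k (w c))) (pred (refine k (h c))) pt v

fill : ℕ → ℤ² → Bool → Pattern → Pattern
fill k pt v c = c ∪ refinedCoset k pt v c

module _ (k : ℕ) (pt : ℤ²) (v : Bool) (c : Pattern) where
  private
    d = refinedCoset k pt v c

  fill-≼ : fill k pt v c ≼ c
  fill-≼ = ∪-≼ˡ {c} {d}

  fill-value : colour c pt ≡ nothing → colour (fill k pt v c) pt ≡ just v
  fill-value undefined = trans (∪-undefinedˡ {c} {d} undefined) (coset-∈ (≡mod⟨⟩-refl pt))

  fill-defined : ∃ λ b → colour (fill k pt v c) pt ≡ just b
  fill-defined = defined (colour c pt) refl
    where
    defined : ∀ m → colour c pt ≡ m → ∃ λ b → colour (fill k pt v c) pt ≡ just b
    defined (just b) e = b , fill-≼ pt e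
    defined nothing  e = v , fill-value e

  fill-undefined : ∀ {z} → colour c z ≡ nothing →
    ¬ z ≡ pt mod⟨ refine k (w c) , refine k (h c) ⟩ →
    colour (fill k pt v c) z ≡ nothing
  fill-undefined undefined z≢pt = trans (∪-undefinedˡ {c} {d} undefined) (coset-∉ z≢pt)

  fill-hole : ∀ {z} → colour c z ≡ nothing → ∃ λ z' → colour (fill k pt v c) z' ≡ nothing
  fill-hole {z} undefined with z ≡? pt mod⟨ refine k (w c) , refine k (h c) ⟩
  ... | no z≢pt  = z , fill-undefined undefined z≢pt
  ... | yes z≡pt = z' , fill-undefined (trans (colour-cong c (≡mod⟨⟩-period z)) undefined) z'≢pt
    where
    z' = z -² (+ suc (w c) , 0ℤ)
    z'≢pt : ¬ z' ≡ pt mod⟨ refine k (w c) , refine k (h c) ⟩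
    z'≢pt z'≡pt with ≡mod⟨⟩-trans z'≡pt (≡mod⟨⟩-sym z≡pt)
    ... | z'≡z , _ with small-multiple≡0 (+≡mod⇒∣ z'≡z)
                           (ℕ.m<m*n (suc (w c)) (suc (suc k)) (ℕ.s≤s (ℕ.s≤s ℕ.z≤n)))
    ... | ()

shift unshift : ℤ² → Pattern → Pattern
shift s c = record
  { w = w c ; h = h c
  ; colour = λ z → colour c (z -² s)
  ; colour-cong = colour-cong c ∘ ≡mod⟨⟩-translate (- proj₁ s , - proj₂ s) }
unshift s c = record
  { w = w c ; h = h c
  ; colour = λ z → colour c (z +² s)
  ; colour-cong = colour-cong c ∘ ≡mod⟨⟩-translate s }

unshift-shift-≼ : ∀ s {c} → unshift s (shift s c) ≼ c
unshift-shift-≼ s {c} z e = trans (cong (colour c) (z+s-s≡z z s)) e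

Extends-unshift : ∀ s {x c} → Extends x (unshift s c) → Extends (s · x) c
Extends-unshift s {c = c} x⊇c z e = x⊇c (z -² s) (trans (cong (colour c) (z-s+s≡z z s)) e)

-- Conditions

record Condition : Set where
  field
    pat  : Pattern
    hole : ∃ λ z → colour pat z ≡ nothing
open Condition

infix 4 _⊑_

_⊑_ : Condition → Condition → Set
c ⊑ d = pat c ≼ pat d

emptyCondition : Condition
emptyCondition = record
  { pat = record { w = 0 ; h = 0 ; colour = λ _ → nothing ; colour-cong = λ _ → refl }
  ; hole = zero² , refl }

fillᶜ : ℕ → ℤ² → Bool → Condition → Condition
fillᶜ k pt v c = record
  { pat = fill k pt v (pat c) ; hole = fill-hole k pt v (pat c) (proj₂ (hole c)) }

shiftᶜ unshiftᶜ : ℤ² → Condition → Condition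
shiftᶜ s c = record
  { pat = shift s (pat c)
  ; hole = proj₁ (hole c) +² s , trans (cong (colour (pat c)) (z+s-s≡z _ s)) (proj₂ (hole c)) }
unshiftᶜ s c = record
  { pat = unshift s (pat c)
  ; hole = proj₁ (hole c) -² s , trans (cong (colour (pat c)) (z-s+s≡z _ s)) (proj₂ (hole c)) }

-- Colour z₀ - g, then give the hole z₀ the opposite colour: the first coset is
-- fine enough (k ≥ |g₁| + |g₂|) to leave z₀ uncoloured unless g = 0.
break-period : ∀ g c → Σ Condition λ c' → c' ⊑ c ×
  (∀ {x} → Extends x (pat c') → ¬ g ≡ zero² → ¬ Periodic g x)
break-period g c =
  c₂ , (λ z → fill-≼ 0 z₀ (not b) (pat c₁) z ∘ fill-≼ k (z₀ -² g) false (pat c) z) , not-periodic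
  where
  z₀ = proj₁ (hole c)
  k = ∣ proj₁ g ∣ ℕ.+ ∣ proj₂ g ∣
  c₁ = fillᶜ k (z₀ -² g) false c
  coloured : ∃ λ b → colour (pat c₁) (z₀ -² g) ≡ just b
  coloured = fill-defined k (z₀ -² g) false (pat c)
  b = proj₁ coloured
  c₂ = fillᶜ 0 z₀ (not b) c₁

  below : ∀ p i → i ℕ.≤ k → i < suc p ℕ.* suc (suc k)
  below p i i≤k = ℕ.<-≤-trans (ℕ.s≤s (ℕ.m≤n⇒m≤1+n i≤k)) (ℕ.m≤n*m _ (suc p))

  not-periodic : ∀ {x} → Extends x (pat c₂) → ¬ g ≡ zero² → ¬ Periodic g x
  not-periodic {x} x⊇c₂ g≢0 periodic =
    not-¬ refl (trans (sym x[z₀-g]≡b) (trans (periodic z₀) x[z₀]≡not-b))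
    where
    z₀-uncoloured : colour (pat c₁) z₀ ≡ nothing
    z₀-uncoloured = fill-undefined k (z₀ -² g) false (pat c) (proj₂ (hole c)) λ z₀≡z₀-g →
      g≢0 (small-period≡0 z₀ g (below (w (pat c)) _ (ℕ.m≤m+n _ _))
                                (below (h (pat c)) _ (ℕ.m≤n+m _ _)) (≡mod⟨⟩-sym z₀≡z₀-g))
    x[z₀]≡not-b : x z₀ ≡ not b
    x[z₀]≡not-b = x⊇c₂ z₀ (fill-value 0 z₀ (not b) (pat c₁) z₀-uncoloured)
    x[z₀-g]≡b : x (z₀ -² g) ≡ b
    x[z₀-g]≡b = x⊇c₂ (z₀ -² g) (fill-≼ 0 z₀ (not b) (pat c₁) (z₀ -² g) (proj₂ coloured))

-- Forcing

-- A dense set of conditions, given by a choice of an element below each condition.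
record Dense : Set where
  field
    extend   : Condition → Condition
    extend-⊑ : ∀ c → extend c ⊑ c
open Dense

Meets : Point → Dense → Set
Meets x D = ∃ λ c → Extends x (pat (extend D c))

Family : Set
Family = ℕ → Dense

Generic : Family → Point → Set
Generic F x = ∀ n → Meets x (F n)

Forces : Family → Condition → (Point → Set) → Set
Forces F c A = ∀ x → Free x → Generic F x → Extends x (pat c) → A x

Forces-⊑ : ∀ {F c d A} → c ⊑ d → Forces F d A → Forces F c A
Forces-⊑ c⊑d forced x free generic x⊇c = forced x free generic (λ z → x⊇c z ∘ c⊑d z)

Decides : Family → Condition → (Point → Set) → Set
Decides F c A = Forces F c A ⊎ Forces F c (¬_ ∘ A)

DenselyDecided : (Point → Set) → Set
DenselyDecided A = Σ Family λ F → ∀ c → Σ Condition λ c' → c' ⊑ c × Decides F c' A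

allConditions : Dense
allConditions = record { extend = λ c → c ; extend-⊑ = λ c → ≼-refl {pat c} }

interleave : (ℕ → Family) → Family
interleave F n = F (proj₁ (unpair n)) (proj₂ (unpair n))

Generic-interleave : ∀ {F x} → Generic (interleave F) x → ∀ k → Generic (F k) x
Generic-interleave generic k i with unpair-surjective (k , i)
... | n , refl = generic n

shiftDense : ℤ² → Dense → Dense
shiftDense s D = record
  { extend = λ c → unshiftᶜ s (extend D (shiftᶜ s c))
  ; extend-⊑ = λ c z → extend-⊑ D (shiftᶜ s c) (z +² s) ∘ unshift-shift-≼ s {pat c} z }

Meets-shift : ∀ {x} s D → Meets x (shiftDense s D) → Meets (s · x) D
Meets-shift {x} s D (c , x⊇) = shiftᶜ s c , Extends-unshift s {x} {pat (extend D (shiftᶜ s c))} x⊇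

shifted : Family → ℕ → Family
shifted F m r = shiftDense (ℕ→ℤ² r) (F m)

shiftClosure : Family → Family
shiftClosure F = interleave (shifted F)

Generic-shift : ∀ {F x} → Generic (shiftClosure F) x → ∀ s → Generic F (s · x)
Generic-shift {F} generic s m with ℕ→ℤ²-surjective s
... | r , refl = Meets-shift s (F m) (Generic-interleave {shifted F} generic m r)

Forces-lattice : ∀ {F c A x} → Forces F c A →
  Free x → Generic (shiftClosure F) x → Extends x (pat c) → ContainsLattice (λ s → A (s · x))
Forces-lattice {F} {c} forced free generic x⊇c = zero² , w (pat c) , h (pat c) , λ i j →
  forced _ (Free-· _ free) (Generic-shift {F} generic _) (Extends-lattice (pat c) i j x⊇c)

-- Borel sets are densely decided

cylinder-decided : ∀ pt b → DenselyDecided (λ x → x pt ≡ b)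
cylinder-decided pt b = (λ _ → allConditions) , λ c →
  fillᶜ 0 pt false c , fill-≼ 0 pt false (pat c) ,
  decide {fillᶜ 0 pt false c} (fill-defined 0 pt false (pat c))
  where
  decide : ∀ {c} → (∃ λ b' → colour (pat c) pt ≡ just b') →
    Decides (λ _ → allConditions) c (λ x → x pt ≡ b)
  decide (b' , e) with b' Bool.≟ b
  ... | yes refl = inj₁ λ x _ _ x⊇c → x⊇c pt e
  ... | no b'≢b  = inj₂ λ x _ _ x⊇c x[pt]≡b → b'≢b (trans (sym (x⊇c pt e)) x[pt]≡b)

DenselyDecided-map : ∀ {A B} → (∀ {F c} → Decides F c A → Decides F c B) →
  DenselyDecided A → DenselyDecided B
DenselyDecided-map f (F , decide) = F , λ c →
  let c' , c'⊑c , decision = decide c in c' , c'⊑c , f {F} {c'} decision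

complement-decided : ∀ {A} → DenselyDecided A → DenselyDecided (¬_ ∘ A)
complement-decided = DenselyDecided-map λ where
  (inj₁ forced) → inj₂ λ x free generic x⊇c ¬a → ¬a (forced x free generic x⊇c)
  (inj₂ forced) → inj₁ forced

⇔-decided : ∀ {A B} → (∀ x → A x ⇔ B x) → DenselyDecided A → DenselyDecided B
⇔-decided A⇔B = DenselyDecided-map (Sum.map
  (λ forced x free generic x⊇c → Equivalence.to (A⇔B x) (forced x free generic x⊇c))
  (λ forced x free generic x⊇c → forced x free generic x⊇c ∘ Equivalence.from (A⇔B x)))

module Classical (em : ExcludedMiddle) where

  common-extension : ∀ {x} c d → Free x → Extends x (pat c) → Extends x (pat d) →
    Σ Condition λ e → e ⊑ c × e ⊑ d
  common-extension {x} c d free x⊇c x⊇d with em (∃ λ z → colour (pat c ∪ pat d) z ≡ nothing)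
  ... | yes hole =
    record { pat = pat c ∪ pat d ; hole = hole } ,
    ∪-≼ˡ {pat c} {pat d} , ∪-≼ʳ {x} {pat c} {pat d} x⊇c x⊇d
  ... | no no-hole = ⊥-elim (total-not-free (pat c ∪ pat d) (λ z e → no-hole (z , e))
                                            (Extends-∪ {x} {pat c} {pat d} x⊇c x⊇d) free)

  module _ (A : ℕ → Point → Set) (decided : ∀ k → DenselyDecided (A k)) where
    private
      F : ℕ → Family
      F k = proj₁ (decided k)

      decide : ∀ k c → Σ Condition λ c' → c' ⊑ c × Decides (F k) c' (A k)
      decide k = proj₂ (decided k)

      deciding : ℕ → Dense
      deciding k = record
        { extend = λ c → proj₁ (decide k c) ; extend-⊑ = λ c → proj₁ (proj₂ (decide k c)) }

      pick : ℕ → Family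
      pick k zero    = deciding k
      pick k (suc i) = F k i

      Generic-F : ∀ {x} → Generic (interleave pick) x → ∀ k → Generic (F k) x
      Generic-F generic k i = Generic-interleave {pick} generic k (suc i)

    -- If no extension of c forces some A k, then c forces that none holds:
    -- a generic x extending c meets a condition deciding A k, and that
    -- condition is compatible with c, so it cannot force A k.
    union-decided : DenselyDecided (λ x → ∃ λ k → A k x)
    union-decided = interleave pick , decide∪
      where
      decide∪ : ∀ c → Σ Condition λ c' → c' ⊑ c × Decides (interleave pick) c' (λ x → ∃ λ k → A k x)
      decide∪ c with em (∃ λ k → Σ Condition λ c' → c' ⊑ c × Forces (F k) c' (A k))
      ... | yes (k , c' , c'⊑c , forced) =
        c' , c'⊑c , inj₁ λ x free generic x⊇c' → k , forced x free (Generic-F generic k) x⊇c'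
      ... | no none = c , ≼-refl {pat c} , inj₂ refute
        where
        refute : Forces (interleave pick) c (λ x → ¬ ∃ λ k → A k x)
        refute x free generic x⊇c (k , a) with Generic-interleave {pick} generic k zero
        ... | r , x⊇r' with proj₂ (proj₂ (decide k r))
        ... | inj₂ forced¬ = forced¬ x free (Generic-F generic k) x⊇r' a
        ... | inj₁ forced with common-extension c (proj₁ (decide k r)) free x⊇c x⊇r'
        ...   | e , e⊑c , e⊑r' =
          none (k , e , e⊑c , Forces-⊑ {F k} {e} {proj₁ (decide k r)} e⊑r' forced)

  borel-decided : ∀ {A} → Borel A → DenselyDecided A
  borel-decided (cyl pt b)   = cylinder-decided pt b
  borel-decided (compl B)    = complement-decided (borel-decided B)
  borel-decided (union A B)  = union-decided A (borel-decided ∘ B)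
  borel-decided (ext B A⇔A') = ⇔-decided A⇔A' (borel-decided B)

  -- Generic points

  module GenericPoint (F : Family) (start : Condition) where

    chain : ℕ → Condition
    chain zero    = start
    chain (suc n) = proj₁ (break-period (ℕ→ℤ² n) (extend (F n) (chain n)))

    chain-step : ∀ n → chain (suc n) ⊑ extend (F n) (chain n)
    chain-step n = proj₁ (proj₂ (break-period (ℕ→ℤ² n) (extend (F n) (chain n))))

    chain-antitone : ∀ {m n} → m ≤′ n → chain n ⊑ chain m
    chain-antitone ≤′-refl z e = e
    chain-antitone {n = suc n} (≤′-step m≤′n) z =
      chain-step n z ∘ extend-⊑ (F n) (chain n) z ∘ chain-antitone m≤′n z

    chain-coherent : ∀ m n {z b b'} →
      colour (pat (chain m)) z ≡ just b → colour (pat (chain n)) z ≡ just b' → b ≡ b'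
    chain-coherent m n {z} e e' with ℕ.≤-total m n
    ... | inj₁ m≤n = just-injective (trans (sym (chain-antitone (ℕ.≤⇒≤′ m≤n) z e)) e')
    ... | inj₂ n≤m = just-injective (trans (sym e) (chain-antitone (ℕ.≤⇒≤′ n≤m) z e'))

    point : Point
    point z with em (∃ λ n → ∃ λ b → colour (pat (chain n)) z ≡ just b)
    ... | yes (_ , b , _) = b
    ... | no _            = false

    point-extends : ∀ n → Extends point (pat (chain n))
    point-extends n z {b} e with em (∃ λ n → ∃ λ b → colour (pat (chain n)) z ≡ just b)
    ... | yes (m , b' , e') = chain-coherent m n e' e
    ... | no uncoloured     = ⊥-elim (uncoloured (n , b , e))

    point-generic : Generic F point
    point-generic n = chain n , λ z → point-extends (suc n) z ∘ chain-step n z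

    point-free : Free point
    point-free g with ℕ→ℤ²-surjective g
    ... | n , refl =
      proj₂ (proj₂ (break-period (ℕ→ℤ² n) (extend (F n) (chain n)))) (point-extends (suc n))

corollary7p6 : ExcludedMiddle →
    (B : Point → Set) → Borel B → ((x : Point) → B x → Free x) →
    Σ Point λ x → Free x ×
    (ContainsLattice (λ s → B (s · x)) ⊎ ContainsLattice (λ s → ¬ B (s · x)))
corollary7p6 em B borel _ with Classical.borel-decided em borel
... | F , decide with decide emptyCondition
... | c , _ , decision = point , point-free , Sum.map lattice lattice decision
  where
  open Classical.GenericPoint em (shiftClosure F) c
  lattice : ∀ {A} → Forces F c A → ContainsLattice (λ s → A (s · point))
  lattice forced = Forces-lattice {F} {c} forced point-free point-generic (point-extends 0)
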